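{- For every $n\ge1$, the map $\alpha$ from the set $\mathrm{RGF}(n)$ of restricted growth functions over $[n]$ to $T_{n+1}$, defined by $\alpha(f)=1\cdot f'$ where $f'_i=f_i-u_i+\delta_i$, is a bijection.
   Context: A restricted growth function (RGF) over $[m]$ is a word $g=g_1\cdots g_m$ with $g_1=1$ and $g_i\le 1+\max\{g_1,\dots,g_{i-1}\}$ for $2\le i\le m$. $\operatorname{LrMax}(g)=\{i: g_i>g_j \text{ for all } j<i\}$. For $f\in\mathrm{RGF}(n)$: a letter is unique if it occurs exactly once in $f$; $u_i$ is the number of positions $j<i$ with $j\in\operatorname{LrMax}(f)$, $f_j$ unique in $f$, and $f_j<f_i$; $\delta_i=1$ if $i\in\operatorname{LrMax}(f)$ and $f_i$ occurs more than once in $f$, else $\delta_i=0$; $1\cdot f'$ denotes the word $1f'_1\cdots f'_n$. $T_{m}$ is the set of RGFs $g$ over $[m]$ such that for every $i\in\operatorname{LrMax}(g)$ with $g_i=s>1$ there is $j>i$ with $g_j=s-1$. -}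

module Defs where

open import Data.Nat using (ℕ; zero; suc; _+_; _∸_; _≤_; _<_; _≤ᵇ_; _<ᵇ_; _≡ᵇ_; _⊔_)
open import Data.Bool using (Bool; true; false; _∧_; if_then_else_; T)
open import Data.List using (List; []; _∷_; length; map; foldr; take; filterᵇ; upTo; sum; applyUpTo)
open import Data.Product using (_×_; Σ; ∃; ∃-syntax)
open import Relation.Binary.PropositionalEquality using (_≡_)

-- Words are lists of natural numbers; positions are 1-based.
-- at g i = g_i for 1 ≤ i ≤ length g (0 otherwise).
at : List ℕ → ℕ → ℕ
at []       _             = 0
at (x ∷ xs) zero          = 0
at (x ∷ xs) (suc zero)    = x
at (x ∷ xs) (suc (suc i)) = at xs (suc i)

positions : ℕ → List ℕ
positions k = applyUpTo suc k

prefixMax : List ℕ → ℕ → ℕ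
prefixMax g k = foldr _⊔_ 0 (take k g)

IsRGF : ℕ → List ℕ → Set
IsRGF m g =
  length g ≡ m ×
  at g 1 ≡ 1 ×
  (∀ i → 2 ≤ i → i ≤ m → (1 ≤ at g i × at g i ≤ suc (prefixMax g (i ∸ 1))))

isLrMax : List ℕ → ℕ → Bool
isLrMax g i =
  (1 ≤ᵇ i) ∧ (i ≤ᵇ length g) ∧
  foldr (λ j b → (at g j <ᵇ at g i) ∧ b) true (positions (i ∸ 1))

occ : List ℕ → ℕ → ℕ
occ g x = length (filterᵇ (λ y → y ≡ᵇ x) g)

isUnique : List ℕ → ℕ → Bool
isUnique g x = occ g x ≡ᵇ 1

u : List ℕ → ℕ → ℕ
u f i = length (filterᵇ (λ j → isLrMax f j ∧ isUnique f (at f j) ∧ (at f j <ᵇ at f i))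
                        (positions (i ∸ 1)))

δ : List ℕ → ℕ → ℕ
δ f i = if isLrMax f i ∧ (2 ≤ᵇ occ f (at f i)) then 1 else 0

f′ : List ℕ → ℕ → ℕ
f′ f i = (at f i ∸ u f i) + δ f i

α : List ℕ → List ℕ
α f = 1 ∷ map (f′ f) (positions (length f))

IsT : ℕ → List ℕ → Set
IsT m g =
  IsRGF m g ×
  (∀ i → T (isLrMax g i) → 2 ≤ at g i →
     ∃[ j ] (i < j × j ≤ m × suc (at g j) ≡ at g i))

-- Position i of an RGF f is an LrMax position (a record) exactly when f_i = 1 + max(f_1 … f_{i-1}), the
-- first occurrence of its letter. Call a record letter repeated if it occurs more than once, and let L be
-- the list of repeated record letters met so far. Since u_i counts the earlier singleton records, at a
-- record f_i − u_i = |L| + 1, so f′_i = |L| + 2 for a repeated letter and |L| + 1 for a singleton, while at a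
-- non-record f′_i is the index of f_i in L. Hence the prefix maximum of 1·f′ is always |L| + 1, 1·f′ is an
-- RGF, and a new maximum |L| + 2 of 1·f′ is followed by |L| + 1 at the next occurrence of that repeated
-- letter: this is the T-condition. Conversely, a word of T is decoded by a machine tracking (max f, L):
-- |L| + 2 opens a repeated letter, |L| + 1 a singleton one, and v ≤ |L| stands for the letter L_v. Letters
-- opened by |L| + 1 can never recur, and the T-condition makes those opened by |L| + 2 recur, so the
-- decoded word is an RGF whose image is the given word; injectivity holds because decoding inverts α.
module Submission where

open import Defs
open import Data.Bool using (Bool; true; false; _∧_; if_then_else_; T; not)
open import Data.Bool.Properties using (∧-identityʳ; ∧-zeroʳ; not-involutive; T-≡; T-∧)
open import Data.Empty using (⊥-elim)
open import Data.List using (List; []; _∷_; length; map; foldr; filterᵇ; applyUpTo; _∷ʳ_)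
open import Data.List.Properties using (length-map; applyUpTo-∷ʳ; map-applyUpTo; length-applyUpTo)
open import Data.Nat
open import Data.Nat.Properties
open import Algebra.Properties.CommutativeSemigroup +-commutativeSemigroup using (interchange)
open import Data.Product using (_×_; _,_; proj₁; proj₂; ∃-syntax)
open import Data.Sum using (_⊎_; inj₁; inj₂)
open import Data.Unit using (tt)
open import Function.Base using (_∘_)
open import Function.Bundles using (Equivalence)
open import Relation.Binary using (tri<; tri≈; tri>)
open import Relation.Binary.PropositionalEquality
open import Relation.Nullary using (yes; no)

open Equivalence using (to; from)

false≢true : false ≢ true
false≢true ()

T-ext : (b c : Bool) → (T b → T c) → (T c → T b) → b ≡ c
T-ext true true _ _ = refl
T-ext true false f _ = ⊥-elim (f tt)
T-ext false true _ g = ⊥-elim (g tt)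
T-ext false false _ _ = refl

<ᵇ-false : (m n : ℕ) → n ≤ m → (m <ᵇ n) ≡ false
<ᵇ-false m n p with m <ᵇ n in eq
... | true = ⊥-elim (<⇒≱ (<ᵇ⇒< m n (from T-≡ eq)) p)
... | false = refl

<ᵇ-true : (m n : ℕ) → m < n → (m <ᵇ n) ≡ true
<ᵇ-true m n p = to T-≡ (<⇒<ᵇ p)

≡ᵇ-refl : (m : ℕ) → (m ≡ᵇ m) ≡ true
≡ᵇ-refl m = to T-≡ (≡⇒≡ᵇ m m refl)

≡ᵇ-false : (m n : ℕ) → m ≢ n → (m ≡ᵇ n) ≡ false
≡ᵇ-false m n p with m ≡ᵇ n in eq
... | true = ⊥-elim (p (≡ᵇ⇒≡ m n (from T-≡ eq)))
... | false = refl

applyUpTo-at : (g : List ℕ) → applyUpTo (λ i → at g (suc i)) (length g) ≡ g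
applyUpTo-at [] = refl
applyUpTo-at (x ∷ xs) = cong (x ∷_) (applyUpTo-at xs)

at-applyUpTo : (h : ℕ → ℕ) (k i : ℕ) → i < k → at (applyUpTo h k) (suc i) ≡ h i
at-applyUpTo h (suc k) zero p = refl
at-applyUpTo h (suc k) (suc i) (s≤s p) = at-applyUpTo (λ j → h (suc j)) k i p

applyUpTo-cong : (h h' : ℕ → ℕ) (k : ℕ) → (∀ i → i < k → h i ≡ h' i) → applyUpTo h k ≡ applyUpTo h' k
applyUpTo-cong h h' zero e = refl
applyUpTo-cong h h' (suc k) e = cong₂ _∷_ (e 0 (s≤s z≤n))
  (applyUpTo-cong (λ i → h (suc i)) (λ i → h' (suc i)) k (λ i p → e (suc i) (s≤s p)))

length-∷ʳ : (L : List ℕ) (x : ℕ) → length (L ∷ʳ x) ≡ suc (length L)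
length-∷ʳ [] x = refl
length-∷ʳ (y ∷ L) x = cong suc (length-∷ʳ L x)

at-0 : (L : List ℕ) → at L 0 ≡ 0
at-0 [] = refl
at-0 (x ∷ L) = refl

at-∷ʳ : (L : List ℕ) (x v : ℕ) → 1 ≤ v → v ≤ length L → at (L ∷ʳ x) v ≡ at L v
at-∷ʳ (y ∷ L) x (suc zero) p q = refl
at-∷ʳ (y ∷ L) x (suc (suc v)) p (s≤s q) = at-∷ʳ L x (suc v) (s≤s z≤n) q

at-∷ʳ-last : (L : List ℕ) (x : ℕ) → at (L ∷ʳ x) (suc (length L)) ≡ x
at-∷ʳ-last [] x = refl
at-∷ʳ-last (y ∷ []) x = refl
at-∷ʳ-last (y ∷ z ∷ L) x = at-∷ʳ-last (z ∷ L) x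

≤-length-∷ʳ : (L : List ℕ) (x v : ℕ) → v ≤ length (L ∷ʳ x) → v ≤ length L ⊎ v ≡ suc (length L)
≤-length-∷ʳ L x v p with m≤n⇒m<n∨m≡n (subst (v ≤_) (length-∷ʳ L x) p)
... | inj₁ (s≤s q) = inj₁ q
... | inj₂ e = inj₂ e

boolToℕ : Bool → ℕ
boolToℕ true = 1
boolToℕ false = 0

count : (ℕ → Bool) → ℕ → ℕ
count p zero = 0
count p (suc k) = count p k + boolToℕ (p (suc k))

length-filterᵇ-∷ʳ : (p : ℕ → Bool) (xs : List ℕ) (x : ℕ) →
  length (filterᵇ p (xs ∷ʳ x)) ≡ length (filterᵇ p xs) + boolToℕ (p x)
length-filterᵇ-∷ʳ p [] x with p x
... | true = refl
... | false = refl
length-filterᵇ-∷ʳ p (y ∷ xs) x with p y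
... | true = cong suc (length-filterᵇ-∷ʳ p xs x)
... | false = length-filterᵇ-∷ʳ p xs x

length-filterᵇ-positions : (p : ℕ → Bool) (k : ℕ) → length (filterᵇ p (positions k)) ≡ count p k
length-filterᵇ-positions p zero = refl
length-filterᵇ-positions p (suc k) = begin
    length (filterᵇ p (applyUpTo suc (suc k)))
  ≡⟨ cong (λ z → length (filterᵇ p z)) (sym (applyUpTo-∷ʳ suc k)) ⟩
    length (filterᵇ p (applyUpTo suc k ∷ʳ suc k))
  ≡⟨ length-filterᵇ-∷ʳ p (applyUpTo suc k) (suc k) ⟩
    length (filterᵇ p (applyUpTo suc k)) + boolToℕ (p (suc k))
  ≡⟨ cong (_+ boolToℕ (p (suc k))) (length-filterᵇ-positions p k) ⟩
    count p k + boolToℕ (p (suc k)) ∎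
  where open ≡-Reasoning

length-filterᵇ-map : (p : ℕ → Bool) (g : ℕ → ℕ) (xs : List ℕ) →
  length (filterᵇ p (map g xs)) ≡ length (filterᵇ (λ x → p (g x)) xs)
length-filterᵇ-map p g [] = refl
length-filterᵇ-map p g (x ∷ xs) with p (g x)
... | true = cong suc (length-filterᵇ-map p g xs)
... | false = length-filterᵇ-map p g xs

count-cong : (p q : ℕ → Bool) (k : ℕ) → (∀ j → 1 ≤ j → j ≤ k → p j ≡ q j) → count p k ≡ count q k
count-cong p q zero e = refl
count-cong p q (suc k) e = cong₂ _+_ (count-cong p q k (λ j a b → e j a (m≤n⇒m≤1+n b)))
  (cong boolToℕ (e (suc k) (s≤s z≤n) ≤-refl))

occ≡count : (g : List ℕ) (x : ℕ) → occ g x ≡ count (λ j → at g j ≡ᵇ x) (length g)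
occ≡count g x = begin
    length (filterᵇ (λ y → y ≡ᵇ x) g)
  ≡⟨ cong (λ z → length (filterᵇ (λ y → y ≡ᵇ x) z))
       (trans (sym (applyUpTo-at g)) (sym (map-applyUpTo suc (at g) (length g)))) ⟩
    length (filterᵇ (λ y → y ≡ᵇ x) (map (at g) (positions (length g))))
  ≡⟨ length-filterᵇ-map (λ y → y ≡ᵇ x) (at g) (positions (length g)) ⟩
    length (filterᵇ (λ j → at g j ≡ᵇ x) (positions (length g)))
  ≡⟨ length-filterᵇ-positions _ (length g) ⟩
    count (λ j → at g j ≡ᵇ x) (length g) ∎
  where open ≡-Reasoning

count-mono : (p : ℕ → Bool) (k m : ℕ) → k ≤ m → count p k ≤ count p m
count-mono p k m q with m≤n⇒m<n∨m≡n q
count-mono p k (suc m) q | inj₁ (s≤s r) = ≤-trans (count-mono p k m r) (m≤m+n _ _)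
... | inj₂ refl = ≤-refl

count-pos : (p : ℕ → Bool) (j k : ℕ) → p j ≡ true → 1 ≤ j → j ≤ k → 1 ≤ count p k
count-pos p (suc j) k e _ q =
  ≤-trans (subst (λ z → 1 ≤ count p j + boolToℕ z) (sym e) (m≤n+m 1 _)) (count-mono p (suc j) k q)

count-≥2 : (p : ℕ → Bool) (j k m : ℕ) → p j ≡ true → p k ≡ true → 1 ≤ j → j < k → k ≤ m →
  2 ≤ count p m
count-≥2 p j (suc k) m e1 e2 q1 (s≤s q2) q3 = ≤-trans
  (subst (λ z → 2 ≤ count p k + boolToℕ z) (sym e2)
    (subst (2 ≤_) (+-comm 1 (count p k)) (s≤s (count-pos p j k e1 q1 q2))))
  (count-mono p (suc k) m q3)

count-pos⇒∃ : (p : ℕ → Bool) (m : ℕ) → 1 ≤ count p m → ∃[ k ] (1 ≤ k × k ≤ m × p k ≡ true)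
count-pos⇒∃ p zero ()
count-pos⇒∃ p (suc m) q with p (suc m) in eq
... | true = suc m , s≤s z≤n , ≤-refl , eq
... | false with count-pos⇒∃ p m (subst (1 ≤_) (+-identityʳ _) q)
... | k , u , v , w = k , u , m≤n⇒m≤1+n v , w

count-≥2⇒∃≢ : (p : ℕ → Bool) (m j : ℕ) → 2 ≤ count p m →
  ∃[ k ] (1 ≤ k × k ≤ m × k ≢ j × p k ≡ true)
count-≥2⇒∃≢ p zero j ()
count-≥2⇒∃≢ p (suc m) j q with p (suc m) in eq | suc m ≟ j
... | true | no ne = suc m , s≤s z≤n , ≤-refl , ne , eq
... | true | yes refl with count-pos⇒∃ p m (≤-pred (subst (2 ≤_) (+-comm (count p m) 1) q))
...   | k , u , v , w = k , u , m≤n⇒m≤1+n v , <⇒≢ (s≤s v) , w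
count-≥2⇒∃≢ p (suc m) j q | false | _ with count-≥2⇒∃≢ p m j (subst (2 ≤_) (+-identityʳ _) q)
...   | k , u , v , w = k , u , m≤n⇒m≤1+n v , w

count-stable : (p : ℕ → Bool) (m k : ℕ) → m ≤ k → (∀ j → m < j → j ≤ k → p j ≡ false) →
  count p k ≡ count p m
count-stable p m k q f with m≤n⇒m<n∨m≡n q
count-stable p m (suc k) q f | inj₁ (s≤s r) =
  trans (cong (count p k +_) (cong boolToℕ (f (suc k) (s≤s r) ≤-refl)))
    (trans (+-identityʳ _) (count-stable p m k r (λ j u v → f j u (m≤n⇒m≤1+n v))))
... | inj₂ refl = refl

count≡0 : (p : ℕ → Bool) (k : ℕ) → (∀ j → 1 ≤ j → j ≤ k → p j ≡ false) → count p k ≡ 0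
count≡0 p zero f = refl
count≡0 p (suc k) f =
  cong₂ _+_ (count≡0 p k (λ j a b → f j a (m≤n⇒m≤1+n b))) (cong boolToℕ (f (suc k) (s≤s z≤n) ≤-refl))

count-≡1 : (p : ℕ → Bool) (m t : ℕ) → 1 ≤ t → t ≤ m → p t ≡ true →
  (∀ j → 1 ≤ j → j ≤ m → j ≢ t → p j ≡ false) → count p m ≡ 1
count-≡1 p m (suc t) _ q e f = begin
    count p m                       ≡⟨ count-stable p (suc t) m q after ⟩
    count p t + boolToℕ (p (suc t)) ≡⟨ cong₂ _+_ (count≡0 p t before) (cong boolToℕ e) ⟩
    1                               ∎
  where
  open ≡-Reasoning
  after : ∀ j → suc t < j → j ≤ m → p j ≡ false
  after j a b = f j (≤-trans (s≤s z≤n) a) b (>⇒≢ a)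
  before : ∀ j → 1 ≤ j → j ≤ t → p j ≡ false
  before j a b = f j a (≤-trans b (<⇒≤ q)) (<⇒≢ (s≤s b))

boolToℕ-split : (x y : Bool) → boolToℕ x ≡ boolToℕ (x ∧ y) + boolToℕ (x ∧ not y)
boolToℕ-split true true = refl
boolToℕ-split true false = refl
boolToℕ-split false y = refl

count-split : (p q : ℕ → Bool) (k : ℕ) →
  count p k ≡ count (λ j → p j ∧ q j) k + count (λ j → p j ∧ not (q j)) k
count-split p q zero = refl
count-split p q (suc k) =
  trans (cong₂ _+_ (count-split p q k) (boolToℕ-split (p (suc k)) (q (suc k))))
        (interchange (count (λ j → p j ∧ q j) k) (count (λ j → p j ∧ not (q j)) k) _ _)

maxUpTo : (ℕ → ℕ) → ℕ → ℕ
maxUpTo a zero = 0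
maxUpTo a (suc k) = maxUpTo a k ⊔ a (suc k)

maxUpTo-cong : (a a' : ℕ → ℕ) (k : ℕ) → (∀ j → 1 ≤ j → j ≤ k → a j ≡ a' j) →
  maxUpTo a k ≡ maxUpTo a' k
maxUpTo-cong a a' zero e = refl
maxUpTo-cong a a' (suc k) e =
  cong₂ _⊔_ (maxUpTo-cong a a' k (λ j u v → e j u (m≤n⇒m≤1+n v))) (e (suc k) (s≤s z≤n) ≤-refl)

maxUpTo-at-[] : (k : ℕ) → maxUpTo (at []) k ≡ 0
maxUpTo-at-[] zero = refl
maxUpTo-at-[] (suc k) = trans (⊔-identityʳ _) (maxUpTo-at-[] k)

maxUpTo-at-∷ : (x : ℕ) (xs : List ℕ) (k : ℕ) → maxUpTo (at (x ∷ xs)) (suc k) ≡ x ⊔ maxUpTo (at xs) k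
maxUpTo-at-∷ x xs zero = sym (⊔-identityʳ x)
maxUpTo-at-∷ x xs (suc k) = trans (cong (_⊔ at xs (suc k)) (maxUpTo-at-∷ x xs k)) (⊔-assoc x _ _)

prefixMax≡maxUpTo : (g : List ℕ) (k : ℕ) → prefixMax g k ≡ maxUpTo (at g) k
prefixMax≡maxUpTo g zero = refl
prefixMax≡maxUpTo [] (suc k) = sym (maxUpTo-at-[] (suc k))
prefixMax≡maxUpTo (x ∷ xs) (suc k) = trans (cong (x ⊔_) (prefixMax≡maxUpTo xs k)) (sym (maxUpTo-at-∷ x xs k))

≤-maxUpTo : (a : ℕ → ℕ) (k j : ℕ) → 1 ≤ j → j ≤ k → a j ≤ maxUpTo a k
≤-maxUpTo a zero (suc j) p ()
≤-maxUpTo a (suc k) j p q with m≤n⇒m<n∨m≡n q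
... | inj₁ (s≤s r) = ≤-trans (≤-maxUpTo a k j p r) (m≤m⊔n _ _)
... | inj₂ refl = m≤n⊔m _ _

maxUpTo-< : (a : ℕ → ℕ) (k x : ℕ) → 1 ≤ x → (∀ j → 1 ≤ j → j ≤ k → a j < x) → maxUpTo a k < x
maxUpTo-< a zero x p h = p
maxUpTo-< a (suc k) x p h =
  ⊔-lub (maxUpTo-< a k x p (λ j u v → h j u (m≤n⇒m≤1+n v))) (h (suc k) (s≤s z≤n) ≤-refl)

-- IsRGF, stated for the letter function i ↦ g_i.
Restricted : (ℕ → ℕ) → ℕ → Set
Restricted a n = ∀ i → 1 ≤ i → i ≤ n → 1 ≤ a i × a i ≤ suc (maxUpTo a (pred i))

foldr-∧⁻ : (p : ℕ → Bool) (h : ℕ → ℕ) (k : ℕ) → T (foldr (λ j b → p j ∧ b) true (applyUpTo h k)) →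
  ∀ i → i < k → T (p (h i))
foldr-∧⁻ p h (suc k) t zero q = proj₁ (to T-∧ t)
foldr-∧⁻ p h (suc k) t (suc i) (s≤s q) = foldr-∧⁻ p (λ j → h (suc j)) k (proj₂ (to (T-∧ {p (h 0)}) t)) i q

foldr-∧⁺ : (p : ℕ → Bool) (h : ℕ → ℕ) (k : ℕ) → (∀ i → i < k → T (p (h i))) →
  T (foldr (λ j b → p j ∧ b) true (applyUpTo h k))
foldr-∧⁺ p h zero f = tt
foldr-∧⁺ p h (suc k) f =
  from T-∧ (f 0 (s≤s z≤n) , foldr-∧⁺ p (λ j → h (suc j)) k (λ i q → f (suc i) (s≤s q)))

isLrMax⁻ : (g : List ℕ) (i : ℕ) → T (isLrMax g i) →
  1 ≤ i × i ≤ length g × (∀ j → 1 ≤ j → j < i → at g j < at g i)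
isLrMax⁻ g zero ()
isLrMax⁻ g (suc i) t with to (T-∧ {1 ≤ᵇ suc i}) t
... | _ , t2 with to (T-∧ {suc i ≤ᵇ length g}) t2
... | t3 , t4 = s≤s z≤n , ≤ᵇ⇒≤ (suc i) (length g) t3 ,
  λ { (suc j) _ (s≤s q) → <ᵇ⇒< _ _ (foldr-∧⁻ (λ j' → at g j' <ᵇ at g (suc i)) suc i t4 j q) }

isLrMax⁺ : (g : List ℕ) (i : ℕ) → 1 ≤ i → i ≤ length g →
  (∀ j → 1 ≤ j → j < i → at g j < at g i) →
  T (isLrMax g i)
isLrMax⁺ g (suc i) p q f = from T-∧ (tt , from T-∧ (≤⇒≤ᵇ q ,
  foldr-∧⁺ (λ j' → at g j' <ᵇ at g (suc i)) suc i (λ j r → <⇒<ᵇ (f (suc j) (s≤s z≤n) (s≤s r)))))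

isLrMax≡maxUpTo<ᵇ : (g : List ℕ) (i : ℕ) → 1 ≤ i → i ≤ length g → 1 ≤ at g i →
  isLrMax g i ≡ (maxUpTo (at g) (pred i) <ᵇ at g i)
isLrMax≡maxUpTo<ᵇ g (suc i) p q r = T-ext _ _
  (λ t → <⇒<ᵇ (maxUpTo-< (at g) i _ r (λ j u v → proj₂ (proj₂ (isLrMax⁻ g (suc i) t)) j u (s≤s v))))
  (λ t → isLrMax⁺ g (suc i) p q (λ j u v → ≤-<-trans (≤-maxUpTo (at g) i j u (≤-pred v)) (<ᵇ⇒< _ _ t)))

-- The decoder

-- A state (K , L) holds the largest letter K produced so far and the list L of letters that were
-- opened as repeated ones. Reading v, the decoder opens the new letter K + 1, as a repeated letter
-- when v = |L| + 2 and as a singleton when v = |L| + 1; a value v ≤ |L| stands for the letter L_v.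
DecoderState : Set
DecoderState = ℕ × List ℕ

decodeStep : DecoderState → ℕ → DecoderState
decodeStep (K , L) v with v ≟ suc (suc (length L))
... | yes _ = (suc K , L ∷ʳ suc K)
... | no _ with v ≟ suc (length L)
...   | yes _ = (suc K , L)
...   | no _ = (K , L)

decodeLetter : DecoderState → ℕ → ℕ
decodeLetter (K , L) v with suc (length L) ≤? v
... | yes _ = suc K
... | no _ = at L v

decoderState : (ℕ → ℕ) → ℕ → DecoderState
decoderState b zero = (0 , [])
decoderState b (suc i) = decodeStep (decoderState b i) (b (suc i))

decodeStep-new : (K : ℕ) (L : List ℕ) (v : ℕ) → v ≡ suc (suc (length L)) →
  decodeStep (K , L) v ≡ (suc K , L ∷ʳ suc K)
decodeStep-new K L v e with v ≟ suc (suc (length L))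
... | yes _ = refl
... | no ne = ⊥-elim (ne e)

decodeStep-singleton : (K : ℕ) (L : List ℕ) (v : ℕ) → v ≡ suc (length L) → decodeStep (K , L) v ≡ (suc K , L)
decodeStep-singleton K L v e with v ≟ suc (suc (length L))
... | yes e' = ⊥-elim (<⇒≢ (n<1+n _) (trans (sym e) e'))
... | no _ with v ≟ suc (length L)
...   | yes _ = refl
...   | no ne = ⊥-elim (ne e)

decodeStep-old : (K : ℕ) (L : List ℕ) (v : ℕ) → v ≤ length L → decodeStep (K , L) v ≡ (K , L)
decodeStep-old K L v p with v ≟ suc (suc (length L))
... | yes e' = ⊥-elim (1+n≰n (≤-trans (≤-reflexive (sym e')) (m≤n⇒m≤1+n p)))
... | no _ with v ≟ suc (length L)
...   | yes e' = ⊥-elim (1+n≰n (≤-trans (≤-reflexive (sym e')) p))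
...   | no _ = refl

decodeLetter-new : (K : ℕ) (L : List ℕ) (v : ℕ) → suc (length L) ≤ v → decodeLetter (K , L) v ≡ suc K
decodeLetter-new K L v p with suc (length L) ≤? v
... | yes _ = refl
... | no np = ⊥-elim (np p)

decodeLetter-old : (K : ℕ) (L : List ℕ) (v : ℕ) → v ≤ length L → decodeLetter (K , L) v ≡ at L v
decodeLetter-old K L v p with suc (length L) ≤? v
... | yes q = ⊥-elim (<⇒≱ q p)
... | no _ = refl

decodeLetter-cases : (K : ℕ) (L : List ℕ) (v : ℕ) →
  decodeLetter (K , L) v ≡ suc K ⊎ (v ≤ length L × decodeLetter (K , L) v ≡ at L v)
decodeLetter-cases K L v with suc (length L) ≤? v
... | yes _ = inj₁ refl
... | no np = inj₂ (≮⇒≥ np , refl)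

decoderState-cong : (b b' : ℕ → ℕ) (i : ℕ) → (∀ j → 1 ≤ j → j ≤ i → b j ≡ b' j) →
  decoderState b i ≡ decoderState b' i
decoderState-cong b b' zero e = refl
decoderState-cong b b' (suc i) e =
  cong₂ decodeStep (decoderState-cong b b' i (λ j u v → e j u (m≤n⇒m≤1+n v))) (e (suc i) (s≤s z≤n) ≤-refl)

Extends : DecoderState → DecoderState → Set
Extends (K , L) (K' , L') =
  K ≤ K' × length L ≤ length L' × (∀ v → 1 ≤ v → v ≤ length L → at L' v ≡ at L v)

extends-refl : (s : DecoderState) → Extends s s
extends-refl s = ≤-refl , ≤-refl , λ _ _ _ → refl

extends-trans : (s t r : DecoderState) → Extends s t → Extends t r → Extends s r
extends-trans s t r (x1 , x2 , x3) (y1 , y2 , y3) =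
  ≤-trans x1 y1 , ≤-trans x2 y2 , λ v u q → trans (y3 v u (≤-trans q x2)) (x3 v u q)

decodeStep-extends : (K : ℕ) (L : List ℕ) (v : ℕ) → Extends (K , L) (decodeStep (K , L) v)
decodeStep-extends K L v with v ≟ suc (suc (length L))
... | yes _ = n≤1+n K , ≤-trans (n≤1+n _) (≤-reflexive (sym (length-∷ʳ L _))) , λ w u q → at-∷ʳ L _ w u q
... | no _ with v ≟ suc (length L)
...   | yes _ = n≤1+n K , ≤-refl , λ _ _ _ → refl
...   | no _ = extends-refl (K , L)

-- Absence of s from L also covers index 0, where at L 0 ≡ 0 ≢ s.
Absent : ℕ → List ℕ → Set
Absent s L = ∀ v → v ≤ length L → at L v ≢ s

absent-∷ʳ : (s x : ℕ) (L : List ℕ) → Absent s L → x ≢ s → Absent s (L ∷ʳ x)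
absent-∷ʳ s x L ni x≢s zero _ e = ni zero z≤n (trans (at-0 L) (trans (sym (at-0 (L ∷ʳ x))) e))
absent-∷ʳ s x L ni x≢s (suc v) r e with ≤-length-∷ʳ L x (suc v) r
... | inj₁ r' = ni (suc v) r' (trans (sym (at-∷ʳ L x (suc v) (s≤s z≤n) r')) e)
... | inj₂ refl = x≢s (trans (sym (at-∷ʳ-last L x)) e)

decodeStep-absent : (s K : ℕ) (L : List ℕ) (v : ℕ) → s ≤ K → Absent s L →
  Absent s (proj₂ (decodeStep (K , L) v))
decodeStep-absent s K L v s≤K ni with v ≟ suc (suc (length L))
... | yes _ = absent-∷ʳ s (suc K) L ni (λ e → 1+n≰n (subst (_≤ K) (sym e) s≤K))
... | no _ with v ≟ suc (length L)
...   | yes _ = ni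
...   | no _ = ni

≤2+-cases : (v m : ℕ) → v ≤ suc (suc m) → v ≡ suc (suc m) ⊎ v ≡ suc m ⊎ v ≤ m
≤2+-cases v m p with m≤n⇒m<n∨m≡n p
... | inj₂ e = inj₁ e
... | inj₁ (s≤s q) with m≤n⇒m<n∨m≡n q
...   | inj₂ e = inj₂ (inj₁ e)
...   | inj₁ (s≤s r) = inj₂ (inj₂ r)

Bounded : DecoderState → Set
Bounded (K , L) = ∀ v → 1 ≤ v → v ≤ length L → 1 ≤ at L v × at L v ≤ K

Increasing : List ℕ → Set
Increasing L = ∀ v w → 1 ≤ v → v < w → w ≤ length L → at L v < at L w

bounded-∷ʳ : (K : ℕ) (L : List ℕ) → Bounded (K , L) → Bounded (suc K , L ∷ʳ suc K)
bounded-∷ʳ K L bd v u p with ≤-length-∷ʳ L (suc K) v p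
... | inj₁ q = subst (λ z → 1 ≤ z × z ≤ suc K) (sym (at-∷ʳ L _ v u q))
                 (proj₁ (bd v u q) , m≤n⇒m≤1+n (proj₂ (bd v u q)))
... | inj₂ refl = subst (λ z → 1 ≤ z × z ≤ suc K) (sym (at-∷ʳ-last L _)) (s≤s z≤n , ≤-refl)

bounded-suc : (K : ℕ) (L : List ℕ) → Bounded (K , L) → Bounded (suc K , L)
bounded-suc K L bd v u p = proj₁ (bd v u p) , m≤n⇒m≤1+n (proj₂ (bd v u p))

increasing-∷ʳ : (K : ℕ) (L : List ℕ) → Bounded (K , L) → Increasing L → Increasing (L ∷ʳ suc K)
increasing-∷ʳ K L bd ic v w u p q with ≤-length-∷ʳ L (suc K) w q
... | inj₁ r = subst₂ _<_ (sym (at-∷ʳ L _ v u (≤-trans (<⇒≤ p) r)))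
                          (sym (at-∷ʳ L _ w (≤-trans u (<⇒≤ p)) r))
                 (ic v w u p r)
... | inj₂ refl = subst₂ _<_ (sym (at-∷ʳ L _ v u (≤-pred p))) (sym (at-∷ʳ-last L _))
                    (s≤s (proj₂ (bd v u (≤-pred p))))

increasing-injective : (L : List ℕ) → Increasing L → (v w : ℕ) →
  1 ≤ v → v ≤ length L → 1 ≤ w → w ≤ length L →
  at L v ≡ at L w → v ≡ w
increasing-injective L ic v w u p u' p' e with <-cmp v w
... | tri≈ _ x _ = x
... | tri< x _ _ = ⊥-elim (<-irrefl e (ic v w u x p'))
... | tri> _ _ x = ⊥-elim (<-irrefl (sym e) (ic w v u' x p))

-- The encoding of an RGF

-- Function-level versions uᵃ, δᵃ, f′ᵃ of u, δ, f′ for the letter function a of an RGF of length n.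
module Encoding (a : ℕ → ℕ) (n : ℕ) (rgf : Restricted a n) where

  isRecord : ℕ → Bool
  isRecord i = maxUpTo a (pred i) <ᵇ a i

  occurrences : ℕ → ℕ
  occurrences s = count (λ j → a j ≡ᵇ s) n

  singleton : ℕ → Bool
  singleton s = occurrences s ≡ᵇ 1

  repeated : ℕ → Bool
  repeated s = 2 ≤ᵇ occurrences s

  uᵃ : ℕ → ℕ
  uᵃ i = count (λ j → isRecord j ∧ singleton (a j) ∧ (a j <ᵇ a i)) (pred i)

  δᵃ : ℕ → ℕ
  δᵃ i = if isRecord i ∧ repeated (a i) then 1 else 0

  f′ᵃ : ℕ → ℕ
  f′ᵃ i = (a i ∸ uᵃ i) + δᵃ i

  repeatedLetters : ℕ → List ℕ
  repeatedLetters zero = []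
  repeatedLetters (suc i) =
    if isRecord (suc i) ∧ repeated (a (suc i)) then repeatedLetters i ∷ʳ a (suc i) else repeatedLetters i

  record-cases : ∀ i → suc i ≤ n →
    (isRecord (suc i) ≡ true × a (suc i) ≡ suc (maxUpTo a i)) ⊎
    (isRecord (suc i) ≡ false × a (suc i) ≤ maxUpTo a i)
  record-cases i p with isRecord (suc i) in eq
  ... | true = inj₁ (refl , ≤-antisym (proj₂ (rgf (suc i) (s≤s z≤n) p)) (<ᵇ⇒< _ _ (from T-≡ eq)))
  ... | false = inj₂ (refl , ≮⇒≥ (λ q → subst T eq (<⇒<ᵇ q)))

  maxUpTo-record : ∀ i → a (suc i) ≡ suc (maxUpTo a i) → maxUpTo a (suc i) ≡ suc (maxUpTo a i)
  maxUpTo-record i e = trans (m≤n⇒m⊔n≡n (subst (maxUpTo a i ≤_) (sym e) (n≤1+n _))) e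

  maxUpTo-nonRecord : ∀ i → a (suc i) ≤ maxUpTo a i → maxUpTo a (suc i) ≡ maxUpTo a i
  maxUpTo-nonRecord i e = m≥n⇒m⊔n≡m e

  maxUpTo≡countRecords : ∀ i → i ≤ n → maxUpTo a i ≡ count isRecord i
  maxUpTo≡countRecords zero p = refl
  maxUpTo≡countRecords (suc i) p with record-cases i p
  ... | inj₁ (e , v) = trans (maxUpTo-record i v) (trans (cong suc (maxUpTo≡countRecords i (<⇒≤ p)))
          (trans (+-comm 1 _) (cong (λ z → count isRecord i + boolToℕ z) (sym e))))
  ... | inj₂ (e , v) = trans (maxUpTo-nonRecord i v) (trans (maxUpTo≡countRecords i (<⇒≤ p))
          (trans (sym (+-identityʳ _)) (cong (λ z → count isRecord i + boolToℕ z) (sym e))))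

  record-value : ∀ i → suc i ≤ n → isRecord (suc i) ≡ true → a (suc i) ≡ suc (maxUpTo a i)
  record-value i p e with record-cases i p
  ... | inj₁ (_ , v) = v
  ... | inj₂ (e' , _) = ⊥-elim (false≢true (trans (sym e') e))

  nonRecord-bound : ∀ i → suc i ≤ n → isRecord (suc i) ≡ false → a (suc i) ≤ maxUpTo a i
  nonRecord-bound i p e with record-cases i p
  ... | inj₁ (e' , _) = ⊥-elim (false≢true (trans (sym e) e'))
  ... | inj₂ (_ , v) = v

  record-dominates : ∀ j k → 1 ≤ j → j < k → k ≤ n → isRecord k ≡ true → a j < a k
  record-dominates j (suc k) u (s≤s v) w e =
    subst (a j <_) (sym (record-value k w e)) (s≤s (≤-maxUpTo a k j u v))

  first-record : ∀ i → i ≤ n → ∀ s → 1 ≤ s → s ≤ maxUpTo a i →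
    ∃[ j ] (1 ≤ j × j ≤ i × isRecord j ≡ true × a j ≡ s)
  first-record zero p (suc s) u ()
  first-record (suc i) p s u w with record-cases i p
  ... | inj₂ (e , v) with first-record i (<⇒≤ p) s u (subst (s ≤_) (maxUpTo-nonRecord i v) w)
  ...   | j , x , y , z = j , x , m≤n⇒m≤1+n y , z
  first-record (suc i) p s u w | inj₁ (e , v) with m≤n⇒m<n∨m≡n (subst (s ≤_) (maxUpTo-record i v) w)
  ... | inj₁ (s≤s r) with first-record i (<⇒≤ p) s u r
  ...   | j , x , y , z = j , x , m≤n⇒m≤1+n y , z
  first-record (suc i) p s u w | inj₁ (e , v) | inj₂ r = suc i , s≤s z≤n , ≤-refl , e , trans v (sym r)

  occurrences-pos : ∀ j → 1 ≤ j → j ≤ n → 1 ≤ occurrences (a j)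
  occurrences-pos j u v = count-pos _ j n (≡ᵇ-refl (a j)) u v

  repeated-twice : ∀ j k → 1 ≤ j → j < k → k ≤ n → a j ≡ a k → repeated (a j) ≡ true
  repeated-twice j k u v w e = to T-≡ (≤⇒≤ᵇ
    (count-≥2 _ j k n (≡ᵇ-refl (a j)) (trans (cong (_≡ᵇ a j) (sym e)) (≡ᵇ-refl (a j))) u v w))

  ≡ᵇ1≡not-2≤ᵇ : ∀ c → 1 ≤ c → (c ≡ᵇ 1) ≡ not (2 ≤ᵇ c)
  ≡ᵇ1≡not-2≤ᵇ (suc zero) _ = refl
  ≡ᵇ1≡not-2≤ᵇ (suc (suc c)) _ = refl

  not-singleton : ∀ j → 1 ≤ j → j ≤ n → not (singleton (a j)) ≡ repeated (a j)
  not-singleton j u v = trans (cong not (≡ᵇ1≡not-2≤ᵇ (occurrences (a j)) (occurrences-pos j u v)))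
                              (not-involutive (repeated (a j)))

  length-repeatedLetters : ∀ i → length (repeatedLetters i) ≡ count (λ j → isRecord j ∧ repeated (a j)) i
  length-repeatedLetters zero = refl
  length-repeatedLetters (suc i) with isRecord (suc i) ∧ repeated (a (suc i))
  ... | true = trans (length-∷ʳ (repeatedLetters i) _) (trans (cong suc (length-repeatedLetters i)) (+-comm 1 _))
  ... | false = trans (length-repeatedLetters i) (sym (+-identityʳ _))

  uᵃ-record : ∀ i → suc i ≤ n → isRecord (suc i) ≡ true →
    uᵃ (suc i) ≡ count (λ j → isRecord j ∧ singleton (a j)) i
  uᵃ-record i p e = count-cong _ _ i (λ j u v → cong (isRecord j ∧_) (trans (cong (singleton (a j) ∧_)
     (<ᵇ-true _ _ (subst (a j <_) (sym (record-value i p e)) (s≤s (≤-maxUpTo a i j u v)))))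
     (∧-identityʳ _)))

  -- A later occurrence of a record letter sees no new smaller records, so it has the same u.
  uᵃ-first : ∀ i j0 → suc i ≤ n → 1 ≤ j0 → j0 ≤ i → isRecord j0 ≡ true → a j0 ≡ a (suc i) →
    uᵃ (suc i) ≡ uᵃ j0
  uᵃ-first i (suc j0) p u v e e' = trans
     (count-stable _ j0 i (<⇒≤ v) no-new-record)
     (count-cong _ _ j0 (λ j _ _ → cong (λ z → isRecord j ∧ singleton (a j) ∧ (a j <ᵇ z)) (sym e')))
    where
    no-new-record : ∀ j → j0 < j → j ≤ i → (isRecord j ∧ singleton (a j) ∧ (a j <ᵇ a (suc i))) ≡ false
    no-new-record j x y with isRecord j in eq
    ... | false = refl
    ... | true with m≤n⇒m<n∨m≡n x
    ...   | inj₂ refl =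
      trans (cong (singleton (a (suc j0)) ∧_) (<ᵇ-false _ _ (≤-reflexive (sym e')))) (∧-zeroʳ _)
    ...   | inj₁ r = trans (cong (singleton (a j) ∧_) (<ᵇ-false _ _ (subst (_≤ a j) e'
              (<⇒≤ (record-dominates (suc j0) j (s≤s z≤n) r (≤-trans y (<⇒≤ p)) eq))))) (∧-zeroʳ _)

  -- The records up to i are the singleton ones counted by u and the repeated ones listed in repeatedLetters.
  record-shift : ∀ i → suc i ≤ n → isRecord (suc i) ≡ true →
    a (suc i) ∸ uᵃ (suc i) ≡ suc (length (repeatedLetters i))
  record-shift i p e = begin
      a (suc i) ∸ uᵃ (suc i)
    ≡⟨ cong₂ _∸_ (record-value i p e) (uᵃ-record i p e) ⟩
      suc (maxUpTo a i) ∸ X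
    ≡⟨ cong (λ z → suc z ∸ X)
         (trans (maxUpTo≡countRecords i (<⇒≤ p)) (count-split isRecord (λ j → singleton (a j)) i)) ⟩
      suc (X + Y) ∸ X
    ≡⟨ cong (_∸ X) (sym (+-suc X Y)) ⟩
      (X + suc Y) ∸ X
    ≡⟨ m+n∸m≡n X (suc Y) ⟩
      suc Y
    ≡⟨ cong suc (trans (count-cong _ _ i
                          (λ j u v → cong (isRecord j ∧_) (not-singleton j u (≤-trans v (<⇒≤ p)))))
                       (sym (length-repeatedLetters i))) ⟩
      suc (length (repeatedLetters i)) ∎
    where
    open ≡-Reasoning
    X = count (λ j → isRecord j ∧ singleton (a j)) i
    Y = count (λ j → isRecord j ∧ not (singleton (a j))) i

  StoredIn : List ℕ → ℕ → Set
  StoredIn L j = 1 ≤ a j ∸ uᵃ j × a j ∸ uᵃ j ≤ length L × at L (a j ∸ uᵃ j) ≡ a j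

  storedIn-∷ʳ : ∀ L x j → StoredIn L j → StoredIn (L ∷ʳ x) j
  storedIn-∷ʳ L x j (r1 , r2 , r3) =
    r1 , ≤-trans r2 (≤-trans (n≤1+n _) (≤-reflexive (sym (length-∷ʳ L x)))) , trans (at-∷ʳ L x _ r1 r2) r3

  storedIn-last : ∀ L j → a j ∸ uᵃ j ≡ suc (length L) → StoredIn (L ∷ʳ a j) j
  storedIn-last L j e =
    subst (1 ≤_) (sym e) (s≤s z≤n) ,
    subst (_≤ length (L ∷ʳ a j)) (sym e) (≤-reflexive (sym (length-∷ʳ L _))) ,
    trans (cong (at (L ∷ʳ a j)) e) (at-∷ʳ-last L _)

  storedIn-transport : ∀ L j k → a j ≡ a k → uᵃ j ≡ uᵃ k → StoredIn L j → StoredIn L k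
  storedIn-transport L j k e e' (r1 , r2 , r3) =
    subst (λ x → 1 ≤ x × x ≤ length L × at L x ≡ a k) (cong₂ _∸_ e e') (r1 , r2 , trans r3 e)

  StoresRepeatedRecords : ℕ → Set
  StoresRepeatedRecords i = ∀ j → 1 ≤ j → j ≤ i → isRecord j ≡ true → repeated (a j) ≡ true →
    StoredIn (repeatedLetters i) j

  NewRepeated NewSingleton OldLetter : ℕ → Set
  NewRepeated i = isRecord (suc i) ≡ true × repeated (a (suc i)) ≡ true ×
                  a (suc i) ∸ uᵃ (suc i) ≡ suc (length (repeatedLetters i))
  NewSingleton i = isRecord (suc i) ≡ true × repeated (a (suc i)) ≡ false ×
                   a (suc i) ∸ uᵃ (suc i) ≡ suc (length (repeatedLetters i))
  OldLetter i = isRecord (suc i) ≡ false × StoredIn (repeatedLetters i) (suc i)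

  -- A non-record letter is a repeated record letter, stored at its first occurrence with the same u.
  letter-cases-step : ∀ i → suc i ≤ n → StoresRepeatedRecords i → NewRepeated i ⊎ NewSingleton i ⊎ OldLetter i
  letter-cases-step i p stored with record-cases i p
  ... | inj₁ (e , v) with repeated (a (suc i)) in eq
  ...   | true = inj₁ (e , refl , record-shift i p e)
  ...   | false = inj₂ (inj₁ (e , refl , record-shift i p e))
  letter-cases-step i p stored | inj₂ (e , v)
    with first-record i (<⇒≤ p) (a (suc i)) (proj₁ (rgf (suc i) (s≤s z≤n) p)) v
  ... | j0 , x , y , z , w = inj₂ (inj₂ (e ,
          storedIn-transport (repeatedLetters i) j0 (suc i) w (sym (uᵃ-first i j0 p x y z w))
            (stored j0 x y z (repeated-twice j0 (suc i) x (s≤s y) p w))))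

  repeatedLetters-new : ∀ i → isRecord (suc i) ≡ true → repeated (a (suc i)) ≡ true →
    repeatedLetters (suc i) ≡ repeatedLetters i ∷ʳ a (suc i)
  repeatedLetters-new i e1 e2 rewrite e1 | e2 = refl

  repeatedLetters-singleton : ∀ i → repeated (a (suc i)) ≡ false → repeatedLetters (suc i) ≡ repeatedLetters i
  repeatedLetters-singleton i e rewrite e | ∧-zeroʳ (isRecord (suc i)) = refl

  repeatedLetters-old : ∀ i → isRecord (suc i) ≡ false → repeatedLetters (suc i) ≡ repeatedLetters i
  repeatedLetters-old i e rewrite e = refl

  storesRepeatedRecords-step : ∀ i → suc i ≤ n → StoresRepeatedRecords i → StoresRepeatedRecords (suc i)
  storesRepeatedRecords-step i p stored j u v e1 e2 with letter-cases-step i p stored | m≤n⇒m<n∨m≡n v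
  ... | inj₁ (c1 , c2 , c3) | inj₁ (s≤s r) =
    subst (λ L → StoredIn L j) (sym (repeatedLetters-new i c1 c2))
      (storedIn-∷ʳ (repeatedLetters i) (a (suc i)) j (stored j u r e1 e2))
  ... | inj₁ (c1 , c2 , c3) | inj₂ refl =
    subst (λ L → StoredIn L j) (sym (repeatedLetters-new i c1 c2)) (storedIn-last (repeatedLetters i) j c3)
  ... | inj₂ (inj₁ (c1 , c2 , c3)) | inj₁ (s≤s r) =
    subst (λ L → StoredIn L j) (sym (repeatedLetters-singleton i c2)) (stored j u r e1 e2)
  ... | inj₂ (inj₁ (c1 , c2 , c3)) | inj₂ refl = ⊥-elim (false≢true (trans (sym c2) e2))
  ... | inj₂ (inj₂ (c1 , _)) | inj₁ (s≤s r) =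
    subst (λ L → StoredIn L j) (sym (repeatedLetters-old i c1)) (stored j u r e1 e2)
  ... | inj₂ (inj₂ (c1 , _)) | inj₂ refl = ⊥-elim (false≢true (trans (sym c1) e1))

  storesRepeatedRecords : ∀ i → i ≤ n → StoresRepeatedRecords i
  storesRepeatedRecords zero p (suc j) u () e1 e2
  storesRepeatedRecords (suc i) p = storesRepeatedRecords-step i p (storesRepeatedRecords i (<⇒≤ p))

  letter-cases : ∀ i → suc i ≤ n → NewRepeated i ⊎ NewSingleton i ⊎ OldLetter i
  letter-cases i p = letter-cases-step i p (storesRepeatedRecords i (<⇒≤ p))

  f′ᵃ-new : ∀ i → NewRepeated i → f′ᵃ (suc i) ≡ suc (suc (length (repeatedLetters i)))
  f′ᵃ-new i (c1 , c2 , c3) rewrite c1 | c2 = trans (cong (_+ 1) c3) (+-comm _ 1)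

  f′ᵃ-singleton : ∀ i → NewSingleton i → f′ᵃ (suc i) ≡ suc (length (repeatedLetters i))
  f′ᵃ-singleton i (c1 , c2 , c3) rewrite c2 | ∧-zeroʳ (isRecord (suc i)) = trans (+-identityʳ _) c3

  f′ᵃ-nonRecord : ∀ i → isRecord (suc i) ≡ false → f′ᵃ (suc i) ≡ a (suc i) ∸ uᵃ (suc i)
  f′ᵃ-nonRecord i c rewrite c = +-identityʳ _

  f′ᵃ-old-bound : ∀ i → OldLetter i → f′ᵃ (suc i) ≤ length (repeatedLetters i)
  f′ᵃ-old-bound i (c1 , c2 , c3 , c4) = subst (_≤ length (repeatedLetters i)) (sym (f′ᵃ-nonRecord i c1)) c3

  decoderState-f′ᵃ : ∀ i → i ≤ n → decoderState f′ᵃ i ≡ (maxUpTo a i , repeatedLetters i)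
  decoderState-f′ᵃ zero p = refl
  decoderState-f′ᵃ (suc i) p rewrite decoderState-f′ᵃ i (<⇒≤ p) with letter-cases i p
  ... | inj₁ c@(c1 , c2 , c3) = trans (decodeStep-new _ _ _ (f′ᵃ-new i c))
        (cong₂ _,_ (sym (maxUpTo-record i (record-value i p c1)))
          (trans (cong (repeatedLetters i ∷ʳ_) (sym (record-value i p c1))) (sym (repeatedLetters-new i c1 c2))))
  ... | inj₂ (inj₁ c@(c1 , c2 , c3)) = trans (decodeStep-singleton _ _ _ (f′ᵃ-singleton i c))
        (cong₂ _,_ (sym (maxUpTo-record i (record-value i p c1))) (sym (repeatedLetters-singleton i c2)))
  ... | inj₂ (inj₂ c@(c1 , _)) = trans (decodeStep-old _ _ _ (f′ᵃ-old-bound i c))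
        (cong₂ _,_ (sym (maxUpTo-nonRecord i (nonRecord-bound i p c1))) (sym (repeatedLetters-old i c1)))

  decodeLetter-f′ᵃ : ∀ i → suc i ≤ n → decodeLetter (decoderState f′ᵃ i) (f′ᵃ (suc i)) ≡ a (suc i)
  decodeLetter-f′ᵃ i p rewrite decoderState-f′ᵃ i (<⇒≤ p) with letter-cases i p
  ... | inj₁ c@(c1 , _) =
    trans (decodeLetter-new _ _ _ (≤-trans (n≤1+n _) (≤-reflexive (sym (f′ᵃ-new i c)))))
          (sym (record-value i p c1))
  ... | inj₂ (inj₁ c@(c1 , _)) =
    trans (decodeLetter-new _ _ _ (≤-reflexive (sym (f′ᵃ-singleton i c)))) (sym (record-value i p c1))
  ... | inj₂ (inj₂ c@(c1 , c2 , c3 , c4)) = trans (decodeLetter-old _ _ _ (f′ᵃ-old-bound i c))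
        (trans (cong (at (repeatedLetters i)) (f′ᵃ-nonRecord i c1)) c4)

  -- The letter function of 1 · f′.
  α′ : ℕ → ℕ
  α′ zero = 0
  α′ (suc zero) = 1
  α′ (suc (suc j)) = f′ᵃ (suc j)

  maxUpTo-α′ : ∀ i → i ≤ n → maxUpTo α′ (suc i) ≡ suc (length (repeatedLetters i))
  maxUpTo-α′ zero p = refl
  maxUpTo-α′ (suc i) p rewrite maxUpTo-α′ i (<⇒≤ p) with letter-cases i p
  ... | inj₁ c@(c1 , c2 , _) = begin
      suc ℓ ⊔ f′ᵃ (suc i)                            ≡⟨ cong (suc ℓ ⊔_) (f′ᵃ-new i c) ⟩
      suc ℓ ⊔ suc (suc ℓ)                            ≡⟨ m≤n⇒m⊔n≡n (n≤1+n _) ⟩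
      suc (suc ℓ)                                    ≡⟨ cong suc (sym (length-∷ʳ (repeatedLetters i) _)) ⟩
      suc (length (repeatedLetters i ∷ʳ a (suc i)))  ≡⟨ cong (suc ∘ length) (sym (repeatedLetters-new i c1 c2)) ⟩
      suc (length (repeatedLetters (suc i)))         ∎
    where
    open ≡-Reasoning
    ℓ = length (repeatedLetters i)
  ... | inj₂ (inj₁ c@(_ , c2 , _)) = trans (cong (suc (length (repeatedLetters i)) ⊔_) (f′ᵃ-singleton i c))
        (trans (⊔-idem _) (cong (suc ∘ length) (sym (repeatedLetters-singleton i c2))))
  ... | inj₂ (inj₂ c@(c1 , _)) = trans (m≥n⇒m⊔n≡m (m≤n⇒m≤1+n (f′ᵃ-old-bound i c)))
        (cong (suc ∘ length) (sym (repeatedLetters-old i c1)))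

  f′ᵃ-bounds : ∀ i → suc i ≤ n → 1 ≤ f′ᵃ (suc i) × f′ᵃ (suc i) ≤ suc (suc (length (repeatedLetters i)))
  f′ᵃ-bounds i p with letter-cases i p
  ... | inj₁ c = subst (λ z → 1 ≤ z × z ≤ suc (suc (length (repeatedLetters i)))) (sym (f′ᵃ-new i c))
                   (s≤s z≤n , ≤-refl)
  ... | inj₂ (inj₁ c) = subst (λ z → 1 ≤ z × z ≤ suc (suc (length (repeatedLetters i)))) (sym (f′ᵃ-singleton i c))
                          (s≤s z≤n , n≤1+n _)
  ... | inj₂ (inj₂ c@(c1 , c2 , _)) = subst (1 ≤_) (sym (f′ᵃ-nonRecord i c1)) c2 ,
        m≤n⇒m≤1+n (m≤n⇒m≤1+n (f′ᵃ-old-bound i c))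

  -- Only a new repeated letter exceeds the prefix maximum; its next occurrence is a non-record with the same u.
  new-maximum-drops-later : ∀ i → suc i ≤ n → suc (suc (length (repeatedLetters i))) ≤ f′ᵃ (suc i) →
    ∃[ k ] (suc i < k × k ≤ n × suc (f′ᵃ k) ≡ f′ᵃ (suc i))
  new-maximum-drops-later i p big with letter-cases i p
  ... | inj₂ (inj₁ c) = ⊥-elim (1+n≰n (subst (suc (suc (length (repeatedLetters i))) ≤_) (f′ᵃ-singleton i c) big))
  ... | inj₂ (inj₂ c) = ⊥-elim (1+n≰n (≤-trans big (m≤n⇒m≤1+n (f′ᵃ-old-bound i c))))
  ... | inj₁ c@(c1 , c2 , c3)
    with count-≥2⇒∃≢ (λ j → a j ≡ᵇ a (suc i)) n (suc i) (≤ᵇ⇒≤ 2 _ (from T-≡ c2))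
  ...   | k , u , v , ne , w with <-cmp k (suc i)
  ...     | tri≈ _ x _ = ⊥-elim (ne x)
  ...     | tri< x _ _ = ⊥-elim (<-irrefl (≡ᵇ⇒≡ _ _ (from T-≡ w)) (record-dominates k (suc i) u x p c1))
  new-maximum-drops-later i p big | inj₁ c@(c1 , c2 , c3) | suc k , u , v , ne , w | tri> _ _ (s≤s x) =
      suc k , s≤s x , v , trans (cong suc f′ᵃ-k) (sym (f′ᵃ-new i c))
    where
    same : a (suc k) ≡ a (suc i)
    same = ≡ᵇ⇒≡ _ _ (from T-≡ w)
    nonRecord : isRecord (suc k) ≡ false
    nonRecord = <ᵇ-false _ _ (subst (_≤ maxUpTo a k) (sym same) (≤-maxUpTo a k (suc i) (s≤s z≤n) x))
    f′ᵃ-k : f′ᵃ (suc k) ≡ suc (length (repeatedLetters i))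
    f′ᵃ-k = trans (f′ᵃ-nonRecord k nonRecord)
              (trans (cong₂ _∸_ same (uᵃ-first k (suc i) v (s≤s z≤n) x c1 (sym same))) c3)

-- Decoding a word of T

-- H is the letter function of a word h = 1 · b of T, with the RGF and T conditions stated for b.
module Decoding (H : ℕ → ℕ) (n : ℕ) (H1 : H 1 ≡ 1)
  (hR : ∀ j → 1 ≤ j → j ≤ n → 1 ≤ H (suc j) × H (suc j) ≤ suc (maxUpTo H j))
  (hT : ∀ j → 1 ≤ j → j ≤ n → maxUpTo H j < H (suc j) →
        ∃[ k ] (j < k × k ≤ n × suc (H (suc k)) ≡ H (suc j)))
  where

  b : ℕ → ℕ
  b j = H (suc j)

  S : ℕ → DecoderState
  S i = decoderState b i

  K : ℕ → ℕ
  K i = proj₁ (S i)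

  L : ℕ → List ℕ
  L i = proj₂ (S i)

  Invariant : ℕ → DecoderState → Set
  Invariant i s = maxUpTo H (suc i) ≡ suc (length (proj₂ s)) × Bounded s × Increasing (proj₂ s)

  ReadsNew ReadsSingleton ReadsOld : ℕ → Set
  ReadsNew i = b (suc i) ≡ suc (suc (length (L i)))
  ReadsSingleton i = b (suc i) ≡ suc (length (L i))
  ReadsOld i = 1 ≤ b (suc i) × b (suc i) ≤ length (L i)

  read-cases-step : ∀ i → suc i ≤ n → maxUpTo H (suc i) ≡ suc (length (L i)) →
    ReadsNew i ⊎ ReadsSingleton i ⊎ ReadsOld i
  read-cases-step i p d1 with hR (suc i) (s≤s z≤n) p
  ... | r1 , r2 with ≤2+-cases (b (suc i)) (length (L i)) (subst (λ z → b (suc i) ≤ suc z) d1 r2)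
  ...   | inj₁ e = inj₁ e
  ...   | inj₂ (inj₁ e) = inj₂ (inj₁ e)
  ...   | inj₂ (inj₂ e) = inj₂ (inj₂ (r1 , e))

  state-new : ∀ i → ReadsNew i → S (suc i) ≡ (suc (K i) , L i ∷ʳ suc (K i))
  state-new i e = decodeStep-new (K i) (L i) (b (suc i)) e

  state-singleton : ∀ i → ReadsSingleton i → S (suc i) ≡ (suc (K i) , L i)
  state-singleton i e = decodeStep-singleton (K i) (L i) (b (suc i)) e

  state-old : ∀ i → ReadsOld i → S (suc i) ≡ (K i , L i)
  state-old i e = decodeStep-old (K i) (L i) (b (suc i)) (proj₂ e)

  invariant : ∀ i → i ≤ n → Invariant i (S i)
  invariant zero p = H1 , (λ { zero () _ ; (suc v) _ () }) , (λ { v zero u () q ; v (suc w) u x () })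
  invariant (suc i) p with invariant i (<⇒≤ p)
  ... | d1 , bd , ic with read-cases-step i p d1
  ...   | inj₁ e = subst (Invariant (suc i)) (sym (state-new i e))
            (trans (cong₂ _⊔_ d1 e) (trans (m≤n⇒m⊔n≡n (n≤1+n _)) (cong suc (sym (length-∷ʳ (L i) _)))) ,
             bounded-∷ʳ (K i) (L i) bd , increasing-∷ʳ (K i) (L i) bd ic)
  ...   | inj₂ (inj₁ e) = subst (Invariant (suc i)) (sym (state-singleton i e))
            (trans (cong₂ _⊔_ d1 e) (⊔-idem _) , bounded-suc (K i) (L i) bd , ic)
  ...   | inj₂ (inj₂ e) = subst (Invariant (suc i)) (sym (state-old i e))
            (trans (cong (_⊔ b (suc i)) d1) (m≥n⇒m⊔n≡m (m≤n⇒m≤1+n (proj₂ e))) , bd , ic)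

  maxUpTo-H : ∀ i → i ≤ n → maxUpTo H (suc i) ≡ suc (length (L i))
  maxUpTo-H i p = proj₁ (invariant i p)

  bounded : ∀ i → i ≤ n → Bounded (S i)
  bounded i p = proj₁ (proj₂ (invariant i p))

  increasing : ∀ i → i ≤ n → Increasing (L i)
  increasing i p = proj₂ (proj₂ (invariant i p))

  read-cases : ∀ i → suc i ≤ n → ReadsNew i ⊎ ReadsSingleton i ⊎ ReadsOld i
  read-cases i p = read-cases-step i p (maxUpTo-H i (<⇒≤ p))

  state-extends : ∀ i k → i ≤ k → Extends (S i) (S k)
  state-extends i k p with m≤n⇒m<n∨m≡n p
  ... | inj₂ refl = extends-refl (S i)
  state-extends i (suc k) p | inj₁ (s≤s r) =
    extends-trans (S i) (S k) (S (suc k)) (state-extends i k r) (decodeStep-extends (K k) (L k) (b (suc k)))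

  decoded : List ℕ
  decoded = applyUpTo (λ i → decodeLetter (S i) (b (suc i))) n

  a : ℕ → ℕ
  a = at decoded

  a-decodeLetter : ∀ i → suc i ≤ n → a (suc i) ≡ decodeLetter (S i) (b (suc i))
  a-decodeLetter i p = at-applyUpTo _ n i p

  a-new : ∀ i → suc i ≤ n → ReadsNew i → a (suc i) ≡ suc (K i)
  a-new i p e = trans (a-decodeLetter i p)
    (decodeLetter-new (K i) (L i) _ (subst (suc (length (L i)) ≤_) (sym e) (n≤1+n _)))

  a-singleton : ∀ i → suc i ≤ n → ReadsSingleton i → a (suc i) ≡ suc (K i)
  a-singleton i p e = trans (a-decodeLetter i p) (decodeLetter-new (K i) (L i) _ (≤-reflexive (sym e)))

  a-old : ∀ i → suc i ≤ n → ReadsOld i → a (suc i) ≡ at (L i) (b (suc i))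
  a-old i p e = trans (a-decodeLetter i p) (decodeLetter-old (K i) (L i) _ (proj₂ e))

  a-old-bounds : ∀ i → suc i ≤ n → ReadsOld i → 1 ≤ a (suc i) × a (suc i) ≤ K i
  a-old-bounds i p e =
    subst (λ z → 1 ≤ z × z ≤ K i) (sym (a-old i p e)) (bounded i (<⇒≤ p) _ (proj₁ e) (proj₂ e))

  maxUpTo-a : ∀ i → i ≤ n → maxUpTo a i ≡ K i
  maxUpTo-a zero p = refl
  maxUpTo-a (suc i) p with read-cases i p
  ... | inj₁ e = trans (cong₂ _⊔_ (maxUpTo-a i (<⇒≤ p)) (a-new i p e))
          (trans (m≤n⇒m⊔n≡n (n≤1+n _)) (sym (cong proj₁ (state-new i e))))
  ... | inj₂ (inj₁ e) = trans (cong₂ _⊔_ (maxUpTo-a i (<⇒≤ p)) (a-singleton i p e))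
          (trans (m≤n⇒m⊔n≡n (n≤1+n _)) (sym (cong proj₁ (state-singleton i e))))
  ... | inj₂ (inj₂ e) = trans (cong (_⊔ a (suc i)) (maxUpTo-a i (<⇒≤ p)))
          (trans (m≥n⇒m⊔n≡m (proj₂ (a-old-bounds i p e))) (sym (cong proj₁ (state-old i e))))

  decoded-restricted : Restricted a n
  decoded-restricted (suc i) _ p rewrite maxUpTo-a i (<⇒≤ p) with read-cases i p
  ... | inj₁ e = subst (λ z → 1 ≤ z × z ≤ suc (K i)) (sym (a-new i p e)) (s≤s z≤n , ≤-refl)
  ... | inj₂ (inj₁ e) = subst (λ z → 1 ≤ z × z ≤ suc (K i)) (sym (a-singleton i p e)) (s≤s z≤n , ≤-refl)
  ... | inj₂ (inj₂ e) = proj₁ (a-old-bounds i p e) , m≤n⇒m≤1+n (proj₂ (a-old-bounds i p e))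

  open Encoding a n decoded-restricted public

  record-new : ∀ i → suc i ≤ n → a (suc i) ≡ suc (K i) → isRecord (suc i) ≡ true
  record-new i p e = <ᵇ-true _ _ (subst₂ _<_ (sym (maxUpTo-a i (<⇒≤ p))) (sym e) ≤-refl)

  nonRecord-old : ∀ i → suc i ≤ n → ReadsOld i → isRecord (suc i) ≡ false
  nonRecord-old i p e =
    <ᵇ-false _ _ (subst (a (suc i) ≤_) (sym (maxUpTo-a i (<⇒≤ p))) (proj₂ (a-old-bounds i p e)))

  -- Later steps only append letters larger than K i to L.
  singleton-absent-later : ∀ i → suc i ≤ n → ReadsSingleton i → ∀ k → suc i ≤ k →
    Absent (suc (K i)) (L k) × suc (K i) ≤ K k
  singleton-absent-later i p e k q with m≤n⇒m<n∨m≡n q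
  ... | inj₂ refl = subst (λ s → Absent (suc (K i)) (proj₂ s) × suc (K i) ≤ proj₁ s) (sym (state-singleton i e))
        ((λ { zero _ x → 0≢1+n (trans (sym (at-0 (L i))) x)
            ; (suc v) r x → 1+n≰n (subst (_≤ K i) x (proj₂ (bounded i (<⇒≤ p) (suc v) (s≤s z≤n) r))) }) ,
         ≤-refl)
  singleton-absent-later i p e (suc k) q | inj₁ (s≤s r) with singleton-absent-later i p e k r
  ... | absent , le = decodeStep-absent _ (K k) (L k) (b (suc k)) le absent ,
                      ≤-trans le (proj₁ (decodeStep-extends (K k) (L k) (b (suc k))))

  occurrences-singleton : ∀ i → suc i ≤ n → ReadsSingleton i → occurrences (a (suc i)) ≡ 1
  occurrences-singleton i p e =
    count-≡1 _ n (suc i) (s≤s z≤n) p (≡ᵇ-refl (a (suc i))) (λ j u v ne → ≡ᵇ-false _ _ (other j u v ne))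
    where
    other : ∀ j → 1 ≤ j → j ≤ n → j ≢ suc i → a j ≢ a (suc i)
    other (suc k) u v ne x with <-cmp k i
    ... | tri≈ _ y _ = ne (cong suc y)
    ... | tri< y _ _ = 1+n≰n (subst (_≤ K i) (trans x (a-singleton i p e))
             (subst (a (suc k) ≤_) (maxUpTo-a i (<⇒≤ p)) (≤-maxUpTo a i (suc k) u y)))
    ... | tri> _ _ y with singleton-absent-later i p e k y
    ...   | absent , le with decodeLetter-cases (K k) (L k) (b (suc k))
    ...     | inj₁ o =
      1+n≰n (subst (_≤ K k) (trans (sym (a-singleton i p e)) (trans (sym x) (trans (a-decodeLetter k v) o))) le)
    ...     | inj₂ (q , o) =
      absent (b (suc k)) q (trans (sym o) (trans (sym (a-decodeLetter k v)) (trans x (a-singleton i p e))))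

  not-repeated-singleton : ∀ i → suc i ≤ n → ReadsSingleton i → repeated (a (suc i)) ≡ false
  not-repeated-singleton i p e rewrite occurrences-singleton i p e = refl

  -- The T-condition yields a later position k reading |L i| + 1, which by then denotes the letter K i + 1.
  repeated-new : ∀ i → suc i ≤ n → ReadsNew i → repeated (a (suc i)) ≡ true
  repeated-new i p e with hT (suc i) (s≤s z≤n) p (subst₂ _<_ (sym (maxUpTo-H i (<⇒≤ p))) (sym e) ≤-refl)
  ... | suc k , s≤s q , r , w = repeated-twice (suc i) (suc k) (s≤s z≤n) (s≤s q) r (trans (a-new i p e) (sym a-k))
    where
    b-k : b (suc k) ≡ suc (length (L i))
    b-k = suc-injective (trans w e)
    extends : Extends (S (suc i)) (S k)
    extends = state-extends (suc i) k q
    length-L : length (L (suc i)) ≡ suc (length (L i))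
    length-L = trans (cong (length ∘ proj₂) (state-new i e)) (length-∷ʳ (L i) _)
    b-k≤ : b (suc k) ≤ length (L k)
    b-k≤ = subst (_≤ length (L k)) (trans length-L (sym b-k)) (proj₁ (proj₂ extends))
    a-k : a (suc k) ≡ suc (K i)
    a-k = begin
      a (suc k)                ≡⟨ a-decodeLetter k r ⟩
      decodeLetter (S k) (b (suc k))
                               ≡⟨ decodeLetter-old (K k) (L k) _ b-k≤ ⟩
      at (L k) (b (suc k))     ≡⟨ proj₂ (proj₂ extends) (b (suc k)) (subst (1 ≤_) (sym b-k) (s≤s z≤n))
                                    (subst (b (suc k) ≤_) (sym length-L) (≤-reflexive b-k)) ⟩
      at (L (suc i)) (b (suc k))
                               ≡⟨ cong₂ at (cong proj₂ (state-new i e)) b-k ⟩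
      at (L i ∷ʳ suc (K i)) (suc (length (L i)))
                               ≡⟨ at-∷ʳ-last (L i) _ ⟩
      suc (K i)                ∎
      where open ≡-Reasoning

  newRepeated : ∀ i → suc i ≤ n → ReadsNew i → NewRepeated i
  newRepeated i p e = record-new i p (a-new i p e) , repeated-new i p e , record-shift i p (record-new i p (a-new i p e))

  newSingleton : ∀ i → suc i ≤ n → ReadsSingleton i → NewSingleton i
  newSingleton i p e = record-new i p (a-singleton i p e) , not-repeated-singleton i p e ,
                       record-shift i p (record-new i p (a-singleton i p e))

  oldLetter : ∀ i → suc i ≤ n → ReadsOld i → OldLetter i
  oldLetter i p e with letter-cases i p
  ... | inj₁ (c1 , _) = ⊥-elim (false≢true (trans (sym (nonRecord-old i p e)) c1))
  ... | inj₂ (inj₁ (c1 , _)) = ⊥-elim (false≢true (trans (sym (nonRecord-old i p e)) c1))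
  ... | inj₂ (inj₂ c) = c

  repeatedLetters≡L : ∀ i → i ≤ n → repeatedLetters i ≡ L i
  repeatedLetters≡L zero p = refl
  repeatedLetters≡L (suc i) p with read-cases i p
  ... | inj₁ e = let (c1 , c2 , _) = newRepeated i p e in
        trans (repeatedLetters-new i c1 c2)
          (trans (cong₂ _∷ʳ_ (repeatedLetters≡L i (<⇒≤ p)) (a-new i p e)) (sym (cong proj₂ (state-new i e))))
  ... | inj₂ (inj₁ e) = trans (repeatedLetters-singleton i (not-repeated-singleton i p e))
        (trans (repeatedLetters≡L i (<⇒≤ p)) (sym (cong proj₂ (state-singleton i e))))
  ... | inj₂ (inj₂ e) = trans (repeatedLetters-old i (nonRecord-old i p e))
        (trans (repeatedLetters≡L i (<⇒≤ p)) (sym (cong proj₂ (state-old i e))))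

  -- In the old case both values index the same letter in the increasing list L i.
  f′ᵃ≡b : ∀ i → suc i ≤ n → f′ᵃ (suc i) ≡ b (suc i)
  f′ᵃ≡b i p with read-cases i p
  ... | inj₁ e = trans (f′ᵃ-new i (newRepeated i p e))
                   (trans (cong (suc ∘ suc ∘ length) (repeatedLetters≡L i (<⇒≤ p))) (sym e))
  ... | inj₂ (inj₁ e) = trans (f′ᵃ-singleton i (newSingleton i p e))
                          (trans (cong (suc ∘ length) (repeatedLetters≡L i (<⇒≤ p))) (sym e))
  ... | inj₂ (inj₂ e) with oldLetter i p e
  ...   | c@(c1 , c2 , c3 , c4) = trans (f′ᵃ-nonRecord i c1)
          (increasing-injective (L i) (increasing i (<⇒≤ p)) _ _ c2 (subst (λ l → _ ≤ length l) L-eq c3)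
            (proj₁ e) (proj₂ e)
            (trans (cong (λ l → at l (a (suc i) ∸ uᵃ (suc i))) (sym L-eq)) (trans c4 (a-old i p e))))
    where
    L-eq : repeatedLetters i ≡ L i
    L-eq = repeatedLetters≡L i (<⇒≤ p)

isRGF⇒restricted : (n : ℕ) (f : List ℕ) → IsRGF n f → Restricted (at f) n
isRGF⇒restricted n f (_ , f1 , rgf) (suc zero) _ p =
  subst (λ z → 1 ≤ z × z ≤ 1) (sym f1) (s≤s z≤n , s≤s z≤n)
isRGF⇒restricted n f (_ , f1 , rgf) (suc (suc k)) _ p with rgf (suc (suc k)) (s≤s (s≤s z≤n)) p
... | x , y = x , subst (λ z → at f (suc (suc k)) ≤ suc z) (prefixMax≡maxUpTo f (suc k)) y

restricted⇒isRGF : (n : ℕ) (f : List ℕ) → length f ≡ n → 1 ≤ n → Restricted (at f) n → IsRGF n f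
restricted⇒isRGF n f len n≥1 rgf = len , f1 , λ { (suc i) _ p → growth i p }
  where
  f1 : at f 1 ≡ 1
  f1 = ≤-antisym (proj₂ (rgf 1 ≤-refl n≥1)) (proj₁ (rgf 1 ≤-refl n≥1))
  growth : ∀ i → suc i ≤ n → 1 ≤ at f (suc i) × at f (suc i) ≤ suc (prefixMax f i)
  growth i p = subst (λ z → 1 ≤ at f (suc i) × at f (suc i) ≤ suc z) (sym (prefixMax≡maxUpTo f i))
                 (rgf (suc i) (s≤s z≤n) p)

f′≡f′ᵃ : (f : List ℕ) (n : ℕ) → length f ≡ n → (rgf : Restricted (at f) n) →
  ∀ i → 1 ≤ i → i ≤ n → f′ f i ≡ Encoding.f′ᵃ (at f) n rgf i
f′≡f′ᵃ f .(length f) refl rgf (suc i) _ p = cong₂ _+_ (cong (at f (suc i) ∸_) u≡uᵃ) δ≡δᵃ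
  where
  open Encoding (at f) (length f) rgf
  isLrMax≡isRecord : ∀ j → 1 ≤ j → j ≤ length f → isLrMax f j ≡ isRecord j
  isLrMax≡isRecord j u v = isLrMax≡maxUpTo<ᵇ f j u v (proj₁ (rgf j u v))
  u≡uᵃ : u f (suc i) ≡ uᵃ (suc i)
  u≡uᵃ = trans (length-filterᵇ-positions _ i) (count-cong _ _ i (λ j x y →
    cong₂ _∧_ (isLrMax≡isRecord j x (≤-trans y (<⇒≤ p)))
              (cong (_∧ (at f j <ᵇ at f (suc i))) (cong (_≡ᵇ 1) (occ≡count f (at f j))))))
  δ≡δᵃ : δ f (suc i) ≡ δᵃ (suc i)
  δ≡δᵃ = cong (λ z → if z then 1 else 0)
    (cong₂ _∧_ (isLrMax≡isRecord (suc i) (s≤s z≤n) p) (cong (2 ≤ᵇ_) (occ≡count f (at f (suc i)))))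

at-α : (f : List ℕ) (n : ℕ) → length f ≡ n → ∀ j → j < n → at (α f) (suc (suc j)) ≡ f′ f (suc j)
at-α f .(length f) refl j p = trans (cong (λ l → at l (suc j)) (map-applyUpTo suc (f′ f) (length f)))
                   (at-applyUpTo (λ i → f′ f (suc i)) (length f) j p)

length-α : (f : List ℕ) → length (α f) ≡ suc (length f)
length-α f = cong suc (trans (length-map (f′ f) (positions (length f))) (length-applyUpTo suc (length f)))

α-into-T : (n : ℕ) (f : List ℕ) → IsRGF n f → IsT (suc n) (α f)
α-into-T .(length f) f rgf@(refl , _) =
  restricted⇒isRGF (suc n) (α f) (length-α f) (s≤s z≤n) α-restricted , T-condition
  where
  n = length f
  open Encoding (at f) n (isRGF⇒restricted n f rgf)
  at-α≡f′ᵃ : ∀ j → j < n → at (α f) (suc (suc j)) ≡ f′ᵃ (suc j)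
  at-α≡f′ᵃ j p =
    trans (at-α f n refl j p) (f′≡f′ᵃ f n refl (isRGF⇒restricted n f rgf) (suc j) (s≤s z≤n) p)
  at-α≡α′ : ∀ j → 1 ≤ j → j ≤ suc n → at (α f) j ≡ α′ j
  at-α≡α′ (suc zero) _ _ = refl
  at-α≡α′ (suc (suc j)) _ (s≤s p) = at-α≡f′ᵃ j p
  maxUpTo-α : ∀ i → i ≤ n → maxUpTo (at (α f)) (suc i) ≡ suc (length (repeatedLetters i))
  maxUpTo-α i p =
    trans (maxUpTo-cong _ _ (suc i) (λ j u v → at-α≡α′ j u (≤-trans v (s≤s p)))) (maxUpTo-α′ i p)
  α-restricted : Restricted (at (α f)) (suc n)
  α-restricted (suc zero) _ _ = s≤s z≤n , s≤s z≤n
  α-restricted (suc (suc j)) _ (s≤s p) = subst₂ (λ x y → 1 ≤ x × x ≤ suc y) (sym (at-α≡f′ᵃ j p))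
     (sym (maxUpTo-α j (<⇒≤ p))) (f′ᵃ-bounds j p)
  T-condition : ∀ i → T (isLrMax (α f) i) → 2 ≤ at (α f) i →
    ∃[ j ] (i < j × j ≤ suc n × suc (at (α f) j) ≡ at (α f) i)
  T-condition (suc zero) _ (s≤s ())
  T-condition (suc (suc j)) t two with isLrMax⁻ (α f) (suc (suc j)) t
  ... | _ , bound , above with ≤-pred (subst (suc (suc j) ≤_) (length-α f) bound)
  ...   | p with new-maximum-drops-later j p
                  (subst₂ _<_ (maxUpTo-α j (<⇒≤ p)) (at-α≡f′ᵃ j p)
                    (maxUpTo-< (at (α f)) (suc j) _ (≤-trans (s≤s z≤n) two)
                      (λ j' u' v' → above j' u' (s≤s v'))))
  ...     | suc k , q1 , q2 , q3 = suc (suc k) , s≤s q1 , s≤s q2 ,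
                                   trans (cong suc (at-α≡f′ᵃ k q2)) (trans q3 (sym (at-α≡f′ᵃ j p)))

α-injective : (n : ℕ) (f g : List ℕ) → IsRGF n f → IsRGF n g → α f ≡ α g → f ≡ g
α-injective n f g rgf@(lf , _) rgg@(lg , _) α-eq = begin
    f                                         ≡⟨ sym (applyUpTo-at f) ⟩
    applyUpTo (λ i → at f (suc i)) (length f)  ≡⟨ cong (applyUpTo _) lf ⟩
    applyUpTo (λ i → at f (suc i)) n           ≡⟨ applyUpTo-cong _ _ n at-same ⟩
    applyUpTo (λ i → at g (suc i)) n           ≡⟨ cong (applyUpTo _) (sym lg) ⟩
    applyUpTo (λ i → at g (suc i)) (length g)  ≡⟨ applyUpTo-at g ⟩
    g                                         ∎
  where
  open ≡-Reasoning
  rf = isRGF⇒restricted n f rgf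
  rg = isRGF⇒restricted n g rgg
  module F = Encoding (at f) n rf
  module G = Encoding (at g) n rg
  f′ᵃ-same : ∀ j → 1 ≤ j → j ≤ n → F.f′ᵃ j ≡ G.f′ᵃ j
  f′ᵃ-same (suc j) u p = begin
    F.f′ᵃ (suc j)           ≡⟨ sym (f′≡f′ᵃ f n lf rf (suc j) u p) ⟩
    f′ f (suc j)            ≡⟨ sym (at-α f n lf j p) ⟩
    at (α f) (suc (suc j))  ≡⟨ cong (λ l → at l (suc (suc j))) α-eq ⟩
    at (α g) (suc (suc j))  ≡⟨ at-α g n lg j p ⟩
    f′ g (suc j)            ≡⟨ f′≡f′ᵃ g n lg rg (suc j) u p ⟩
    G.f′ᵃ (suc j)           ∎
  at-same : ∀ i → i < n → at f (suc i) ≡ at g (suc i)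
  at-same i p = begin
    at f (suc i)                                        ≡⟨ sym (F.decodeLetter-f′ᵃ i p) ⟩
    decodeLetter (decoderState F.f′ᵃ i) (F.f′ᵃ (suc i))
      ≡⟨ cong₂ decodeLetter (decoderState-cong _ _ i (λ j u v → f′ᵃ-same j u (≤-trans v (<⇒≤ p))))
                            (f′ᵃ-same (suc i) (s≤s z≤n) p) ⟩
    decodeLetter (decoderState G.f′ᵃ i) (G.f′ᵃ (suc i)) ≡⟨ G.decodeLetter-f′ᵃ i p ⟩
    at g (suc i)                                        ∎

T⇒shifted-restricted : (n : ℕ) (h : List ℕ) → IsRGF (suc n) h →
  ∀ j → 1 ≤ j → j ≤ n → 1 ≤ at h (suc j) × at h (suc j) ≤ suc (maxUpTo (at h) j)
T⇒shifted-restricted n h rgh j u v = isRGF⇒restricted (suc n) h rgh (suc j) (s≤s z≤n) (s≤s v)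

T⇒shifted-condition : (n : ℕ) (h : List ℕ) → IsT (suc n) h →
  ∀ j → 1 ≤ j → j ≤ n → maxUpTo (at h) j < at h (suc j) →
  ∃[ k ] (j < k × k ≤ n × suc (at h (suc k)) ≡ at h (suc j))
T⇒shifted-condition n h ((lh , h1 , _) , T-cond) j u v lt
  with T-cond (suc j) (isLrMax⁺ h (suc j) (s≤s z≤n) (subst (suc j ≤_) (sym lh) (s≤s v))
                        (λ j' u' v' → ≤-<-trans (≤-maxUpTo (at h) j j' u' (≤-pred v')) lt))
                  (≤-trans (s≤s (subst (_≤ maxUpTo (at h) j) h1 (≤-maxUpTo (at h) j 1 ≤-refl u))) lt)
... | suc k , q1 , q2 , q3 = k , ≤-pred q1 , ≤-pred q2 , q3

α-surjective : (n : ℕ) → 1 ≤ n → (h : List ℕ) → IsT (suc n) h → ∃[ f ] (IsRGF n f × α f ≡ h)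
α-surjective n n≥1 h T@((lh , h1 , _) , _) =
  decoded , restricted⇒isRGF n decoded length-decoded n≥1 decoded-restricted , α-decoded
  where
  open Decoding (at h) n h1 (T⇒shifted-restricted n h (proj₁ T)) (T⇒shifted-condition n h T)
  length-decoded : length decoded ≡ n
  length-decoded = length-applyUpTo _ n
  α-decoded : α decoded ≡ h
  α-decoded = begin
    1 ∷ map (f′ decoded) (positions (length decoded))
      ≡⟨ cong (λ m → 1 ∷ map (f′ decoded) (positions m)) length-decoded ⟩
    1 ∷ map (f′ decoded) (positions n)
      ≡⟨ cong (1 ∷_) (map-applyUpTo suc (f′ decoded) n) ⟩
    1 ∷ applyUpTo (λ i → f′ decoded (suc i)) n
      ≡⟨ cong₂ _∷_ (sym h1) (applyUpTo-cong _ _ n (λ i p →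
           trans (f′≡f′ᵃ decoded n length-decoded decoded-restricted (suc i) (s≤s z≤n) p)
                 (f′ᵃ≡b i p))) ⟩
    at h 1 ∷ applyUpTo (λ i → at h (suc (suc i))) n
      ≡⟨ cong (applyUpTo (λ i → at h (suc i))) (sym lh) ⟩
    applyUpTo (λ i → at h (suc i)) (length h)
      ≡⟨ applyUpTo-at h ⟩
    h ∎
    where open ≡-Reasoning

proposition17 : ∀ (n : ℕ) → 1 ≤ n →
    ((f : List ℕ) → IsRGF n f → IsT (suc n) (α f)) ×
    ((f g : List ℕ) → IsRGF n f → IsRGF n g → α f ≡ α g → f ≡ g) ×
    ((h : List ℕ) → IsT (suc n) h → ∃[ f ] (IsRGF n f × α f ≡ h))
proposition17 n n≥1 = α-into-T n , α-injective n , α-surjective n n≥1
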